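{- Let $G=(V,E)$ be an undirected unweighted graph with $n$ vertices and $m$ edges, let $d>0$, let $H$ be a $3d$-connectivity certificate of $G$ with $m'\le\min\{m,3nd\}$ edges, and let $(T,\mathcal P)$ be a partial tree of $G$ that captures all mincuts of size at most $d$ and no mincut of size more than $2d$. For each terminal $u_i\in V(T)$, let $H_i$ be the graph obtained from $H$ by contracting, for every connected component $C$ of $T\setminus\{u_i\}$, the set $V_C=\bigcup_{u\in V(C)}V_u$ into a single vertex, and let $n'_i,m'_i$ be the numbers of vertices and edges of $H_i$ (parallel edges counted with multiplicity). Then $\sum_{u_i\in V(T)}n'_i\le 3n$ and $\sum_{u_i\in V(T)}m'_i\le\min\{3m,5nd\}$.
   Context: $\mathrm{mincut}_G(u,v)$ is the minimum number of edges of $G$ separating $u$ from $v$. A partial tree $(T,\mathcal P)$ of $G$ consists of an edge-weighted tree $T$ on a terminal set $V(T)\subseteq V$ and a partition $\mathcal P$ of $V$ where each part $V_u\in\mathcal P$ contains exactly one terminal $u$, such that for any terminals $u,v$, removing a minimum-weight edge on the $u$-$v$ path of $T$ splits $V(T)$ into $(A_T,B_T)$ and $(\bigcup_{x\in A_T}V_x,\bigcup_{y\in B_T}V_y)$ is a $u$-$v$ mincut of $G$ of size equal to that edge's weight. It captures all mincuts of size at most $d$ if every part $U\in\mathcal P$ has $\mathrm{mincut}_G(u,v)>d$ for all $u,v\in U$; it captures no mincut of size more than $2d$ if every edge of $T$ has weight at most $2d$. A $k$-connectivity certificate of $G$ is a subgraph $H$ with $|E_H(S,V\setminus S)|\ge\min\{|E_G(S,V\setminus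 S)|,k\}$ for every $S\subseteq V$. -}

module Defs where

open import Data.Nat using (ℕ; zero; suc; _+_; _*_; _≤_; _<_)
open import Data.Fin using (Fin; _≟_)
open import Data.Bool using (Bool; true; false; if_then_else_)
import Data.Bool as B
open import Data.List using (List; []; _∷_; length; filter; map; allFin)
open import Data.Nat.ListAction using (sum)
open import Data.Unit using (⊤)
open import Data.List.Membership.Propositional using (_∈_)
open import Data.List.Relation.Unary.All using (All)
open import Data.List.Relation.Unary.AllPairs using (AllPairs)
open import Data.List.Relation.Unary.Unique.Propositional using (Unique)
open import Data.Product using (Σ; _×_; _,_; proj₁; proj₂)
open import Data.Sum using (_⊎_)
open import Relation.Nullary using (¬_; ¬?)
open import Relation.Nullary.Decidable using (⌊_⌋)
open import Relation.Binary.PropositionalEquality using (_≡_; _≢_)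
open import Function.Bundles using (_⇔_)
open import Function.Definitions using (Surjective)

-- Graphs on vertex set Fin n, given by an edge list (undirected edges
-- stored as ordered pairs; the orientation is irrelevant everywhere).

Edge : ℕ → Set
Edge n = Fin n × Fin n

SameUnorderedPair : ∀ {n} → Edge n → Edge n → Set
SameUnorderedPair (a , b) (c , d) = (a ≡ c × b ≡ d) ⊎ (a ≡ d × b ≡ c)

SimpleGraph : ∀ {n} → List (Edge n) → Set
SimpleGraph E = All (λ e → proj₁ e ≢ proj₂ e) E
              × AllPairs (λ e f → ¬ SameUnorderedPair e f) E

VSet : ℕ → Set
VSet n = Fin n → Bool

cut : ∀ {n} → List (Edge n) → VSet n → ℕ
cut E S = length (filter (λ e → ¬? (S (proj₁ e) B.≟ S (proj₂ e))) E)

Separates : ∀ {n} → VSet n → Fin n → Fin n → Set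
Separates S u v = S u ≡ true × S v ≡ false

IsMinCut : ∀ {n} → List (Edge n) → Fin n → Fin n → VSet n → Set
IsMinCut E u v S = Separates S u v × (∀ S' → Separates S' u v → cut E S ≤ cut E S')

MincutGreater : ∀ {n} → List (Edge n) → Fin n → Fin n → ℕ → Set
MincutGreater E u v d = ∀ S → Separates S u v → d < cut E S

-- H is a k-connectivity certificate of G (H is required separately to be
-- a subgraph of G in the statement).
Certificate : ∀ {n} → List (Edge n) → List (Edge n) → ℕ → Set
Certificate G H k = ∀ S → (cut G S Data.Nat.⊓ k) ≤ cut H S

WEdges : ℕ → ℕ → Set
WEdges n k = Fin k → Fin n × Fin n × ℕ

endA endB : ∀ {n k} → WEdges n k → Fin k → Fin n
endA T j = proj₁ (T j)
endB T j = proj₁ (proj₂ (T j))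

weight : ∀ {n k} → WEdges n k → Fin k → ℕ
weight T j = proj₂ (proj₂ (T j))

Joins : ∀ {n k} → WEdges n k → Fin k → Fin n → Fin n → Set
Joins T j a c = (endA T j ≡ a × endB T j ≡ c) ⊎ (endA T j ≡ c × endB T j ≡ a)

data Reach {n k} (T : WEdges n k) (allowed : Fin k → Set) : Fin n → Fin n → Set where
  here : ∀ {a} → Reach T allowed a a
  step : ∀ {a c b} (j : Fin k) → allowed j → Joins T j a c →
         Reach T allowed c b → Reach T allowed a b

AllEdges : ∀ {k} → Fin k → Set
AllEdges _ = ⊤

Without : ∀ {k} → Fin k → Fin k → Set
Without j j' = j' ≢ j

Avoiding : ∀ {n k} → WEdges n k → Fin n → Fin k → Set
Avoiding T t j = endA T j ≢ t × endB T j ≢ t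

data Walk {n k} (T : WEdges n k) : Fin n → Fin n → List (Fin k) → List (Fin n) → Set where
  nil  : ∀ {a} → Walk T a a [] (a ∷ [])
  cons : ∀ {a c b js vs} (j : Fin k) → Joins T j a c →
         Walk T c b js vs → Walk T a b (j ∷ js) (a ∷ vs)

PathEdges : ∀ {n k} → WEdges n k → Fin n → Fin n → List (Fin k) → Set
PathEdges T u v js = Σ (List _) λ vs → Walk T u v js vs × Unique vs

-- Partial trees.  The partition P is given by rep : V → V(T), sending each
-- vertex to the unique terminal of its part; terminals are the fixed points.

Terminal : ∀ {n} → (Fin n → Fin n) → Fin n → Set
Terminal rep t = rep t ≡ t

record PartialTree {n k} (G : List (Edge n)) (rep : Fin n → Fin n) (T : WEdges n k) : Set where
  field
    rep-idem      : ∀ v → Terminal rep (rep v)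
    ends-terminal : ∀ j → Terminal rep (endA T j) × Terminal rep (endB T j)
    connected     : ∀ u v → Terminal rep u → Terminal rep v → Reach T AllEdges u v
    acyclic       : ∀ j → ¬ Reach T (Without j) (endA T j) (endB T j)
    mincut-prop   : ∀ u v → Terminal rep u → Terminal rep v → u ≢ v →
                    ∀ js → PathEdges T u v js → ∀ j → j ∈ js →
                    (∀ j' → j' ∈ js → weight T j ≤ weight T j') →
                    ∀ (S : VSet n) → (∀ x → S x ≡ true ⇔ Reach T (Without j) u (rep x)) →
                    IsMinCut G u v S × cut G S ≡ weight T j

CapturesAllUpTo : ∀ {n} → List (Edge n) → (Fin n → Fin n) → ℕ → Set
CapturesAllUpTo G rep d = ∀ x y → rep x ≡ rep y → x ≢ y → MincutGreater G x y d

CapturesNoneAbove : ∀ {n k} → WEdges n k → ℕ → Set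
CapturesNoneAbove T d = ∀ j → weight T j ≤ 2 * d

SameClass : ∀ {n k} → (Fin n → Fin n) → WEdges n k → Fin n → Fin n → Fin n → Set
SameClass rep T t x y =
  x ≡ y ⊎ (rep x ≢ t × rep y ≢ t × Reach T (Avoiding T t) (rep x) (rep y))

-- c : V → Fin n' is a quotient map realising the contraction, so H_t has
-- n' vertices
IsContraction : ∀ {n k} → (Fin n → Fin n) → WEdges n k → Fin n →
                (n' : ℕ) → (Fin n → Fin n') → Set
IsContraction rep T t n' c =
  Surjective _≡_ _≡_ c × (∀ x y → (c x ≡ c y) ⇔ SameClass rep T t x y)

-- number of edges of the contracted graph (loops removed, parallel edges
-- kept with multiplicity)
contractedEdges : ∀ {n n'} → List (Edge n) → (Fin n → Fin n') → ℕ
contractedEdges H c = length (filter (λ e → ¬? (c (proj₁ e) ≟ c (proj₂ e))) H)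

sumTerminals : ∀ {n} → (Fin n → Fin n) → (Fin n → ℕ) → ℕ
sumTerminals {n} rep f = sum (map (λ v → if ⌊ rep v ≟ v ⌋ then f v else 0) (allFin n))

{-# OPTIONS --safe #-}
-- For a terminal t, a vertex of H_t is either a vertex of V_t or a contracted
-- component of T − t, and distinct components enter t through distinct tree edges;
-- so n'_t ≤ |V_t| + deg_T t, and summing over t gives at most n + 2|E(T)| ≤ 3n.
--
-- An edge xy of H survives in H_t only if t = rep x or the first edge on the tree
-- path from t to rep x separates x from y, and distinct terminals have distinct
-- such edges. Hence Σ m'_t ≤ m' + Σ_j |E_H(S_j)| ≤ m' + Σ_j w(j), where S_j is the
-- side of T − j lifted to V, a mincut of weight w(j). Each w(j) is at most 2d, and
-- at most the degree of the endpoint of j away from a fixed root; these endpoints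
-- are distinct, so Σ_j w(j) ≤ min(2m, 2nd).
module Submission where

open import Defs
open import Data.Nat using (ℕ; zero; suc; _+_; _*_; _≤_; _<_; _⊓_; z≤n; s≤s)
open import Data.Nat.Properties hiding (_≟_; suc-injective; 0≢1+n)
open import Data.Nat.ListAction using (sum)
open import Data.Nat.Tactic.RingSolver using (solve-∀)
open import Data.Bool using (true; false; not; if_then_else_)
import Data.Bool as Bool
open import Data.Fin using (Fin; zero; suc; _≟_; _↑ˡ_; _↑ʳ_; splitAt; join)
open import Data.Fin.Properties using (suc-injective; 0≢1+n; splitAt-↑ˡ; splitAt-↑ʳ; splitAt-join; injective⇒≤)
open import Data.List using (List; []; _∷_; length; filter; map; tabulate; allFin)
open import Data.List.Properties using (map-tabulate)
open import Data.List.Relation.Unary.Any using (here)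
open import Data.List.Relation.Unary.All using ([]; _∷_)
open import Data.List.Relation.Unary.AllPairs using ([]; _∷_)
open import Data.List.Relation.Binary.Sublist.Propositional using (_⊆_; ⊆-refl)
open import Data.List.Relation.Binary.Sublist.Propositional.Properties using (filter⁺; length-mono-≤)
open import Data.Product using (Σ; ∃-syntax; _×_; _,_; proj₁; proj₂)
open import Data.Sum using (_⊎_; inj₁; inj₂; [_,_]′)
open import Data.Sum.Properties using (inj₁-injective)
open import Data.Unit using (tt)
open import Data.Empty using (⊥; ⊥-elim)
open import Function using (_∘_; id; const)
open import Function.Bundles using (_⇔_; mk⇔; Equivalence)
open import Function.Definitions using (Injective)
open import Relation.Binary.PropositionalEquality hiding ([_])
open import Relation.Nullary using (¬_; Dec; yes; no; ¬?; _×-dec_; _⊎-dec_; contradiction)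
open import Relation.Nullary.Decidable using (⌊_⌋)
open import Relation.Unary using (Decidable; _⟨⊎⟩_; _∩_)
open import Relation.Unary.Properties using (_⊎?_; _∪?_; _∩?_; ∁?)
open import Algebra.Properties.CommutativeMonoid.Sum +-0-commutativeMonoid
  using (sum-syntax; ∑-distrib-+; ∑-comm; sum-cong-≗)

private
  variable
    A : Set
    m n : ℕ

𝟙 : {B : Set} → Dec B → ℕ
𝟙 (yes _) = 1
𝟙 (no _)  = 0

count : {P : Fin n → Set} → Decidable P → ℕ
count {n} P? = ∑[ i < n ] 𝟙 (P? i)

∑-mono-≤ : ∀ {f g : Fin n → ℕ} → (∀ i → f i ≤ g i) → ∑[ i < n ] f i ≤ ∑[ i < n ] g i
∑-mono-≤ {zero}  f≤g = z≤n
∑-mono-≤ {suc n} f≤g = +-mono-≤ (f≤g zero) (∑-mono-≤ (f≤g ∘ suc))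

∑-const : ∀ n c → ∑[ i < n ] c ≡ n * c
∑-const zero    c = refl
∑-const (suc n) c = cong (c +_) (∑-const n c)

∑-↑ : ∀ m (f : Fin (m + n) → ℕ) →
      ∑[ z < m + n ] f z ≡ ∑[ i < m ] f (i ↑ˡ n) + ∑[ j < n ] f (m ↑ʳ j)
∑-↑ zero    f = refl
∑-↑ (suc m) f = trans (cong (f zero +_) (∑-↑ m (f ∘ suc))) (sym (+-assoc (f zero) _ _))

term≤∑ : ∀ (f : Fin n → ℕ) i → f i ≤ ∑[ j < n ] f j
term≤∑ f zero    = m≤m+n _ _
term≤∑ f (suc i) = ≤-trans (term≤∑ (f ∘ suc) i) (m≤n+m _ _)

sum-allFin : ∀ n (f : Fin n → ℕ) → sum (map f (allFin n)) ≡ ∑[ i < n ] f i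
sum-allFin n f = trans (cong sum (map-tabulate id f)) (sum-tabulate n)
  where
  sum-tabulate : ∀ n {f : Fin n → ℕ} → sum (tabulate f) ≡ ∑[ i < n ] f i
  sum-tabulate zero        = refl
  sum-tabulate (suc n) {f} = cong (f zero +_) (sum-tabulate n)

𝟙-mono : ∀ {B C : Set} (b : Dec B) (c : Dec C) → (B → C) → 𝟙 b ≤ 𝟙 c
𝟙-mono (yes b) (yes _) _   = ≤-refl
𝟙-mono (yes b) (no ¬c) b→c = contradiction (b→c b) ¬c
𝟙-mono (no _)  c       _   = z≤n

𝟙-⊎ : ∀ {B C : Set} (b : Dec B) (c : Dec C) → 𝟙 (b ⊎-dec c) ≤ 𝟙 b + 𝟙 c
𝟙-⊎ (yes _) c      = s≤s z≤n
𝟙-⊎ (no _) (yes _) = ≤-refl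
𝟙-⊎ (no _) (no _)  = ≤-refl

𝟙-split : ∀ {B C : Set} (b : Dec B) (c : Dec C) → 𝟙 b ≤ 𝟙 c + 𝟙 (b ×-dec ¬? c)
𝟙-split (yes _) (yes _) = s≤s z≤n
𝟙-split (yes _) (no _)  = ≤-refl
𝟙-split (no _)  c       = z≤n

𝟙-partition : ∀ {B C : Set} (b : Dec B) (c : Dec C) → 𝟙 b ≡ 𝟙 (b ×-dec c) + 𝟙 (b ×-dec ¬? c)
𝟙-partition (yes _) (yes _) = refl
𝟙-partition (yes _) (no _)  = refl
𝟙-partition (no _)  c       = refl

module _ {P Q : Fin n → Set} (P? : Decidable P) (Q? : Decidable Q) where

  count-mono : (∀ i → P i → Q i) → count P? ≤ count Q?
  count-mono P⊆Q = ∑-mono-≤ λ i → 𝟙-mono (P? i) (Q? i) (P⊆Q i)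

  count-∪ : count (P? ∪? Q?) ≤ count P? + count Q?
  count-∪ = ≤-trans (∑-mono-≤ λ i → 𝟙-⊎ (P? i) (Q? i)) (≤-reflexive (∑-distrib-+ (𝟙 ∘ P?) (𝟙 ∘ Q?)))

  count-split : count P? ≤ count Q? + count (P? ∩? ∁? Q?)
  count-split = ≤-trans (∑-mono-≤ λ i → 𝟙-split (P? i) (Q? i)) (≤-reflexive (∑-distrib-+ (𝟙 ∘ Q?) _))

count-remove : ∀ {Q : Fin n → Set} (Q? : Decidable Q) {j₀} → Q j₀ →
               1 + count (λ j → Q? j ×-dec ¬? (j ≟ j₀)) ≤ count Q?
count-remove {n} {Q} Q? {j₀} qj₀ = begin
  1 + count (λ j → Q? j ×-dec ¬? (j ≟ j₀))
    ≤⟨ +-monoˡ-≤ _ (≤-trans (j₀-counted (Q? j₀) (j₀ ≟ j₀)) (term≤∑ (λ j → 𝟙 (Q? j ×-dec (j ≟ j₀))) j₀)) ⟩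
  count (λ j → Q? j ×-dec (j ≟ j₀)) + count (λ j → Q? j ×-dec ¬? (j ≟ j₀))
    ≡⟨ ∑-distrib-+ (λ j → 𝟙 (Q? j ×-dec (j ≟ j₀))) _ ⟨
  ∑[ j < n ] (𝟙 (Q? j ×-dec (j ≟ j₀)) + 𝟙 (Q? j ×-dec ¬? (j ≟ j₀)))
    ≡⟨ sum-cong-≗ (λ j → 𝟙-partition (Q? j) (j ≟ j₀)) ⟨
  count Q? ∎
  where
  open ≤-Reasoning
  j₀-counted : (q : Dec (Q j₀)) (e : Dec (j₀ ≡ j₀)) → 1 ≤ 𝟙 (q ×-dec e)
  j₀-counted (yes _) (yes _) = ≤-refl
  j₀-counted (no ¬q) _       = contradiction qj₀ ¬q
  j₀-counted _       (no ¬e) = contradiction refl ¬e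

count-injection : ∀ {P : Fin m → Set} {Q : Fin n → Set} (P? : Decidable P) (Q? : Decidable Q)
                  (f : ∀ i → P i → Fin n) → (∀ i p → Q (f i p)) →
                  (∀ i j p q → f i p ≡ f j q → i ≡ j) → count P? ≤ count Q?
count-injection {zero}  P? Q? f f∈Q f-inj = z≤n
count-injection {suc m} P? Q? f f∈Q f-inj with P? zero
... | no _   = count-injection (P? ∘ suc) Q? (f ∘ suc) (f∈Q ∘ suc)
                 (λ i j p q e → suc-injective (f-inj (suc i) (suc j) p q e))
... | yes p₀ = ≤-trans (s≤s rest) (count-remove Q? (f∈Q zero p₀))
  where
  rest : count (P? ∘ suc) ≤ count (λ j → Q? j ×-dec ¬? (j ≟ f zero p₀))
  rest = count-injection (P? ∘ suc) (λ j → Q? j ×-dec ¬? (j ≟ f zero p₀)) (f ∘ suc)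
           (λ i p → f∈Q (suc i) p , λ e → 0≢1+n (f-inj zero (suc i) p₀ p (sym e)))
           (λ i j p q e → suc-injective (f-inj (suc i) (suc j) p q e))

count-all : ∀ n → count {n} (λ _ → yes tt) ≡ n
count-all n = trans (∑-const n 1) (*-identityʳ n)

injection-≤-count : ∀ {Q : Fin n → Set} (Q? : Decidable Q) (f : Fin m → Fin n) →
                    (∀ i → Q (f i)) → Injective _≡_ _≡_ f → m ≤ count Q?
injection-≤-count {m = m} Q? f f∈Q f-inj = begin
  m                        ≡⟨ count-all m ⟨
  count {m} (λ _ → yes tt)
    ≤⟨ count-injection (λ _ → yes tt) Q? (λ i _ → f i) (λ i _ → f∈Q i) (λ _ _ _ _ → f-inj) ⟩
  count Q?                 ∎
  where open ≤-Reasoning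

count-≤-1 : ∀ {P : Fin n → Set} (P? : Decidable P) → (∀ i j → P i → P j → i ≡ j) → count P? ≤ 1
count-≤-1 P? unique = count-injection P? (λ (_ : Fin 1) → yes tt) (λ _ _ → zero) _ (λ i j p q _ → unique i j p q)

module _ {k} {P : Fin m → Set} {R : Fin k → Set} (P? : Decidable P) (R? : Decidable R) where

  count-splitAt : count {m + k} (λ z → (P? ⊎? R?) (splitAt m z)) ≡ count P? + count R?
  count-splitAt = trans (∑-↑ m _) (cong₂ _+_ (sum-cong-≗ left) (sum-cong-≗ right))
    where
    left : ∀ i → 𝟙 ((P? ⊎? R?) (splitAt m (i ↑ˡ k))) ≡ 𝟙 (P? i)
    left i = cong (𝟙 ∘ (P? ⊎? R?)) (splitAt-↑ˡ m i k)
    right : ∀ j → 𝟙 ((P? ⊎? R?) (splitAt m (m ↑ʳ j))) ≡ 𝟙 (R? j)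
    right j = cong (𝟙 ∘ (P? ⊎? R?)) (splitAt-↑ʳ m k j)

  injection-⊎-≤-count : ∀ {l} (f : Fin l → Fin m ⊎ Fin k) → (∀ i → (P ⟨⊎⟩ R) (f i)) →
                        Injective _≡_ _≡_ f → l ≤ count P? + count R?
  injection-⊎-≤-count f f∈ f-inj = begin
    _ ≤⟨ injection-≤-count (λ z → (P? ⊎? R?) (splitAt m z)) (join m k ∘ f) joined∈ joined-inj ⟩
    count (λ z → (P? ⊎? R?) (splitAt m z)) ≡⟨ count-splitAt ⟩
    count P? + count R? ∎
    where
    open ≤-Reasoning
    joined∈ : ∀ i → (P ⟨⊎⟩ R) (splitAt m (join m k (f i)))
    joined∈ i = subst (P ⟨⊎⟩ R) (sym (splitAt-join m k (f i))) (f∈ i)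
    joined-inj : Injective _≡_ _≡_ (join m k ∘ f)
    joined-inj {i} {j} e =
      f-inj (trans (sym (splitAt-join m k (f i))) (trans (cong (splitAt m) e) (splitAt-join m k (f j))))

count-preimage-≤-1 : ∀ {k} {φ : Fin k → Fin n} → Injective _≡_ _≡_ φ → ∀ x → count (λ j → x ≟ φ j) ≤ 1
count-preimage-≤-1 {φ = φ} φ-inj x =
  count-≤-1 (λ j → x ≟ φ j) (λ _ _ x≡φi x≡φj → φ-inj (trans (sym x≡φi) x≡φj))

length-filter-∷ : ∀ {P : A → Set} (P? : Decidable P) x xs →
                  length (filter P? (x ∷ xs)) ≡ 𝟙 (P? x) + length (filter P? xs)
length-filter-∷ P? x xs with P? x
... | yes _ = refl
... | no _  = refl

∑-length-filter : ∀ {P : Fin n → A → Set} (P? : ∀ t → Decidable (P t)) L →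
                  ∑[ t < n ] length (filter (P? t) L) ≡ sum (map (λ x → count (λ t → P? t x)) L)
∑-length-filter {n} P? []      = trans (∑-const n 0) (*-zeroʳ n)
∑-length-filter {n} P? (x ∷ L) = begin
  ∑[ t < n ] length (filter (P? t) (x ∷ L))          ≡⟨ sum-cong-≗ (λ t → length-filter-∷ (P? t) x L) ⟩
  ∑[ t < n ] (𝟙 (P? t x) + length (filter (P? t) L)) ≡⟨ ∑-distrib-+ (λ t → 𝟙 (P? t x)) _ ⟩
  count (λ t → P? t x) + ∑[ t < n ] length (filter (P? t) L)
    ≡⟨ cong (count (λ t → P? t x) +_) (∑-length-filter P? L) ⟩
  sum (map (λ x → count (λ t → P? t x)) (x ∷ L))     ∎
  where open ≡-Reasoning

module _ {f g : A → ℕ} where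

  sum-map-mono-≤ : (∀ x → f x ≤ g x) → ∀ L → sum (map f L) ≤ sum (map g L)
  sum-map-mono-≤ f≤g []      = z≤n
  sum-map-mono-≤ f≤g (x ∷ L) = +-mono-≤ (f≤g x) (sum-map-mono-≤ f≤g L)

  sum-map-+ : ∀ L → sum (map (λ x → f x + g x) L) ≡ sum (map f L) + sum (map g L)
  sum-map-+ []      = refl
  sum-map-+ (x ∷ L) = trans (cong (f x + g x +_) (sum-map-+ L)) (+-assoc-comm (f x) (g x) _ _)
    where
    +-assoc-comm : ∀ a b c d → a + b + (c + d) ≡ a + c + (b + d)
    +-assoc-comm = solve-∀

sum-map-const : ∀ c (L : List A) → sum (map (λ _ → c) L) ≡ c * length L
sum-map-const c []      = sym (*-zeroʳ c)
sum-map-const c (x ∷ L) = trans (cong (c +_) (sum-map-const c L)) (sym (*-suc c (length L)))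

length-filter-mono : ∀ {P Q : A → Set} (P? : Decidable P) (Q? : Decidable Q) →
                     (∀ x → P x → Q x) → ∀ L → length (filter P? L) ≤ length (filter Q? L)
length-filter-mono P? Q? P⊆Q L = length-mono-≤ (filter⁺ P? Q? (λ { refl p → P⊆Q _ p }) (⊆-refl {x = L}))

crosses? : (S : VSet n) (e : Edge n) → Dec (S (proj₁ e) ≢ S (proj₂ e))
crosses? S (x , y) = ¬? (S x Bool.≟ S y)

singleton : Fin n → VSet n
singleton v z = ⌊ z ≟ v ⌋

cut-mono-⊆ : ∀ {H G : List (Edge n)} (S : VSet n) → H ⊆ G → cut H S ≤ cut G S
cut-mono-⊆ S H⊆G = length-mono-≤ (filter⁺ (crosses? S) (crosses? S) (λ { refl c → c }) H⊆G)

cut-complement : (E : List (Edge n)) (S : VSet n) → cut E (not ∘ S) ≡ cut E S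
cut-complement []           S = refl
cut-complement ((x , y) ∷ E) S = begin
  cut ((x , y) ∷ E) (not ∘ S)                    ≡⟨ length-filter-∷ (crosses? (not ∘ S)) (x , y) E ⟩
  𝟙 (crosses? (not ∘ S) (x , y)) + cut E (not ∘ S) ≡⟨ cong₂ _+_ (not-crosses (S x) (S y)) (cut-complement E S) ⟩
  𝟙 (crosses? S (x , y)) + cut E S               ≡⟨ length-filter-∷ (crosses? S) (x , y) E ⟨
  cut ((x , y) ∷ E) S                            ∎
  where
  open ≡-Reasoning
  not-crosses : ∀ a b → 𝟙 (¬? (not a Bool.≟ not b)) ≡ 𝟙 (¬? (a Bool.≟ b))
  not-crosses false false = refl
  not-crosses false true  = refl
  not-crosses true  false = refl
  not-crosses true  true  = refl

crosses-singleton : ∀ (v x y : Fin n) → singleton v x ≢ singleton v y → x ≡ v ⊎ y ≡ v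
crosses-singleton v x y ≢ with x ≟ v | y ≟ v
... | yes x≡v | _       = inj₁ x≡v
... | no _    | yes y≡v = inj₂ y≡v
... | no _    | no _    = contradiction refl ≢

∑-cut-singleton-≤ : ∀ {k} (E : List (Edge n)) (φ : Fin k → Fin n) → Injective _≡_ _≡_ φ →
                    ∑[ j < k ] cut E (singleton (φ j)) ≤ 2 * length E
∑-cut-singleton-≤ {k = k} E φ φ-inj = begin
  ∑[ j < k ] cut E (singleton (φ j))
    ≡⟨ ∑-length-filter (λ j → crosses? (singleton (φ j))) E ⟩
  sum (map (λ e → count (λ j → crosses? (singleton (φ j)) e)) E)
    ≤⟨ sum-map-mono-≤ per-edge E ⟩
  sum (map (λ _ → 2) E)
    ≡⟨ sum-map-const 2 E ⟩
  2 * length E ∎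
  where
  open ≤-Reasoning
  per-edge : ∀ e → count (λ j → crosses? (singleton (φ j)) e) ≤ 2
  per-edge (x , y) = begin
    count (λ j → crosses? (singleton (φ j)) (x , y))
      ≤⟨ count-mono _ ((λ j → x ≟ φ j) ∪? (λ j → y ≟ φ j)) (λ j → crosses-singleton (φ j) x y) ⟩
    count ((λ j → x ≟ φ j) ∪? (λ j → y ≟ φ j))
      ≤⟨ count-∪ (λ j → x ≟ φ j) (λ j → y ≟ φ j) ⟩
    count (λ j → x ≟ φ j) + count (λ j → y ≟ φ j)
      ≤⟨ +-mono-≤ (count-preimage-≤-1 φ-inj x) (count-preimage-≤-1 φ-inj y) ⟩
    2 ∎

singleton-self : ∀ (v : Fin n) → singleton v v ≡ true
singleton-self v with v ≟ v
... | yes _  = refl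
... | no v≢v = contradiction refl v≢v

singleton-≢ : ∀ {v x : Fin n} → x ≢ v → singleton v x ≡ false
singleton-≢ {v = v} {x} x≢v with x ≟ v
... | yes x≡v = contradiction x≡v x≢v
... | no _    = refl

module Walks {n k : ℕ} (T : WEdges n k) where

  private
    variable
      P Q : Fin k → Set
      a b c s t w : Fin n
      j : Fin k

  Joins-sym : Joins T j a b → Joins T j b a
  Joins-sym (inj₁ e) = inj₂ e
  Joins-sym (inj₂ e) = inj₁ e

  Reach-trans : Reach T P a b → Reach T P b c → Reach T P a c
  Reach-trans here             r′ = r′
  Reach-trans (step j p J r) r′ = step j p J (Reach-trans r r′)

  Reach-sym : Reach T P a b → Reach T P b a
  Reach-sym here           = here
  Reach-sym (step j p J r) = Reach-trans (Reach-sym r) (step j p (Joins-sym J) here)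

  Reach-map : (∀ {j} → P j → Q j) → Reach T P a b → Reach T Q a b
  Reach-map P⊆Q here           = here
  Reach-map P⊆Q (step j p J r) = step j (P⊆Q p) J (Reach-map P⊆Q r)

  IsEnd : Fin k → Fin n → Set
  IsEnd j w = endA T j ≡ w ⊎ endB T j ≡ w

  Joins-end : Joins T j a b → IsEnd j b
  Joins-end (inj₁ (_ , b≡)) = inj₂ b≡
  Joins-end (inj₂ (b≡ , _)) = inj₁ b≡

  Joins-ends : Joins T j a b → IsEnd j w → w ≡ a ⊎ w ≡ b
  Joins-ends (inj₁ (a≡ , b≡)) (inj₁ e) = inj₁ (trans (sym e) a≡)
  Joins-ends (inj₁ (a≡ , b≡)) (inj₂ e) = inj₂ (trans (sym e) b≡)
  Joins-ends (inj₂ (b≡ , a≡)) (inj₁ e) = inj₂ (trans (sym e) b≡)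
  Joins-ends (inj₂ (b≡ , a≡)) (inj₂ e) = inj₁ (trans (sym e) a≡)

  Joins-avoiding : Joins T j a b → a ≢ t → b ≢ t → Avoiding T t j
  Joins-avoiding (inj₁ (a≡ , b≡)) a≢t b≢t = (λ e → a≢t (trans (sym a≡) e)) , (λ e → b≢t (trans (sym b≡) e))
  Joins-avoiding (inj₂ (b≡ , a≡)) a≢t b≢t = (λ e → b≢t (trans (sym b≡) e)) , (λ e → a≢t (trans (sym a≡) e))

  Avoiding-Without : Joins T j a t → ∀ {j′} → Avoiding T t j′ → Without j j′
  Avoiding-Without (inj₁ (_ , t≡)) (_ , ≢t) refl = ≢t t≡
  Avoiding-Without (inj₂ (t≡ , _)) (≢t , _) refl = ≢t t≡

  Joins-ends-of : ∀ j → Joins T j (endA T j) (endB T j)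
  Joins-ends-of j = inj₁ (refl , refl)

  Reach-avoiding-≢ : Reach T (Avoiding T t) a b → a ≢ t → b ≢ t
  Reach-avoiding-≢ here               a≢t = a≢t
  Reach-avoiding-≢ (step j avoid J ρ) _   = Reach-avoiding-≢ ρ (end-≢ (Joins-end J) avoid)
    where
    end-≢ : ∀ {w} → IsEnd j w → Avoiding T _ j → w ≢ _
    end-≢ (inj₁ ≡w) (A≢ , _) w≡t = A≢ (trans ≡w w≡t)
    end-≢ (inj₂ ≡w) (_ , B≢) w≡t = B≢ (trans ≡w w≡t)

  after-last-use : ∀ j₀ → Reach T P s a →
                   Reach T (P ∩ Without j₀) s a ⊎ ∃[ w ] IsEnd j₀ w × Reach T (P ∩ Without j₀) w a
  after-last-use j₀ here = inj₁ here
  after-last-use j₀ (step j p J r) with after-last-use j₀ r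
  ... | inj₂ later = inj₂ later
  ... | inj₁ r′ with j ≟ j₀
  ...   | yes refl = inj₂ (_ , Joins-end J , r′)
  ...   | no j≢j₀  = inj₁ (step j (p , j≢j₀) J r′)

  after-last-visit : ∀ t → Reach T P b a → Reach T (P ∩ Avoiding T t) b a ⊎ Reach T P t a
  after-last-visit t here = inj₁ here
  after-last-visit t (step {a = b} {c = c} j p J r) with after-last-visit t r | b ≟ t | c ≟ t
  ... | inj₂ later | _        | _        = inj₂ later
  ... | inj₁ _     | yes refl | _        = inj₂ (step j p J r)
  ... | inj₁ _     | no _     | yes refl = inj₂ r
  ... | inj₁ r′    | no b≢t   | no c≢t   = inj₁ (step j (p , Joins-avoiding J b≢t c≢t) J r′)

  first-entry : Reach T P a t → a ≢ t → ∃[ j ] ∃[ s ] Joins T j s t × Reach T (P ∩ Avoiding T t) a s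
  first-entry here a≢t = contradiction refl a≢t
  first-entry {t = t} (step {c = c} j p J r) a≢t with c ≟ t
  ... | yes refl = j , _ , J , here
  ... | no c≢t with first-entry r c≢t
  ...   | j′ , s , J′ , r′ = j′ , s , J′ , step j (p , Joins-avoiding J a≢t c≢t) J r′

module PartialTreeProperties {n k : ℕ} {G : List (Edge n)} {rep : Fin n → Fin n} {T : WEdges n k}
             (PT : PartialTree G rep T) where

  open PartialTree PT
  open Walks T

  private
    variable
      a b r s t y : Fin n
      j : Fin k

  no-loop : ∀ j → endA T j ≢ endB T j
  no-loop j e = acyclic j (subst (Reach T (Without j) (endA T j)) e here)

  Joins-acyclic : Joins T j a b → ¬ Reach T (Without j) a b
  Joins-acyclic {j} (inj₁ (a≡ , b≡)) ρ = acyclic j (subst₂ (Reach T (Without j)) (sym a≡) (sym b≡) ρ)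
  Joins-acyclic {j} (inj₂ (b≡ , a≡)) ρ = acyclic j (subst₂ (Reach T (Without j)) (sym b≡) (sym a≡) (Reach-sym ρ))

  Joins-terminal : Joins T j a b → Terminal rep a
  Joins-terminal {j} (inj₁ (a≡ , _)) = subst (Terminal rep) a≡ (proj₁ (ends-terminal j))
  Joins-terminal {j} (inj₂ (_ , a≡)) = subst (Terminal rep) a≡ (proj₂ (ends-terminal j))

  Joins-unique : Joins T j a t → Joins T j b t → a ≡ b
  Joins-unique     (inj₁ (a≡ , _))  (inj₁ (b≡ , _))  = trans (sym a≡) b≡
  Joins-unique {j} (inj₁ (_ , t≡))  (inj₂ (t≡′ , _)) = contradiction (trans t≡′ (sym t≡)) (no-loop j)
  Joins-unique {j} (inj₂ (t≡ , _))  (inj₁ (_ , t≡′)) = contradiction (trans t≡ (sym t≡′)) (no-loop j)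
  Joins-unique     (inj₂ (_ , a≡))  (inj₂ (_ , b≡))  = trans (sym a≡) b≡

  side : Joins T j a b → Terminal rep y → Reach T (Without j) a y ⊎ Reach T (Without j) b y
  side {j} {a} J ty with after-last-use j (connected a _ (Joins-terminal J) ty)
  ... | inj₁ ρ = inj₁ (Reach-map proj₂ ρ)
  ... | inj₂ (w , w-end , ρ) with Joins-ends J w-end
  ...   | inj₁ refl = inj₁ (Reach-map proj₂ ρ)
  ...   | inj₂ refl = inj₂ (Reach-map proj₂ ρ)

  sides-disjoint : Joins T j a b → Reach T (Without j) a y → Reach T (Without j) b y → ⊥
  sides-disjoint J a→y b→y = Joins-acyclic J (Reach-trans a→y (Reach-sym b→y))

  record ParentEdge (r t : Fin n) : Set where
    constructor parent
    field
      edge   : Fin k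
      other  : Fin n
      joins  : Joins T edge t other
      toward : Reach T (Without edge) other r

  open ParentEdge

  parent-edge : Terminal rep r → Terminal rep t → t ≢ r → ParentEdge r t
  parent-edge {r} {t} r-term t-term t≢r with first-entry (connected r t r-term t-term) (λ r≡t → t≢r (sym r≡t))
  ... | j , s , J , r→s = parent j s (Joins-sym J) (Reach-sym (Reach-map (λ p → Avoiding-Without J (proj₂ p)) r→s))

  parent-edge-unique : (D D′ : ParentEdge r t) → edge D ≡ edge D′
  parent-edge-unique (parent a s Ja s→r) (parent b s′ Jb s′→r) with a ≟ b
  ... | yes a≡b = a≡b
  ... | no a≢b with after-last-use a s′→r
  ...   | inj₁ ρ = ⊥-elim (sides-disjoint Ja (step b (λ b≡a → a≢b (sym b≡a)) Jb (Reach-map proj₂ ρ)) s→r)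
  ...   | inj₂ (w , w-end , ρ) with Joins-ends Ja w-end
  ...     | inj₁ refl = ⊥-elim (sides-disjoint Ja (Reach-map proj₂ ρ) s→r)
  ...     | inj₂ refl = ⊥-elim (sides-disjoint Jb (step a a≢b Ja (Reach-map proj₁ ρ)) s′→r)

  parent-edge-injective : (D : ParentEdge r t) (D′ : ParentEdge r y) → edge D ≡ edge D′ → t ≡ y
  parent-edge-injective (parent j s J s→r) (parent .j s′ J′ s′→r) refl with Joins-ends J (Joins-end (Joins-sym J′))
  ... | inj₁ y≡t  = sym y≡t
  ... | inj₂ refl = contradiction s′→r (sides-disjoint J′ s→r)

  parent-edge-separates : (D : ParentEdge r t) → ¬ Reach T (Avoiding T t) r b →
                          ¬ Reach T (Without (edge D)) (other D) b
  parent-edge-separates (parent j s J s→r) r↛b s→b with after-last-visit _ (Reach-trans (Reach-sym s→b) s→r)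
  ... | inj₁ b→r = r↛b (Reach-sym (Reach-map proj₂ b→r))
  ... | inj₂ t→r = sides-disjoint J t→r s→r

  module Rooted (r : Fin n) (r-term : Terminal rep r) where

    ChildOf : Fin k → Set
    ChildOf j = ∃[ v ] Σ (ParentEdge r v) (λ D → edge D ≡ j)

    child-of : ∀ j → ChildOf j
    child-of j with side (Joins-ends-of j) r-term
    ... | inj₁ A→r = endB T j , parent j (endA T j) (Joins-sym (Joins-ends-of j)) A→r , refl
    ... | inj₂ B→r = endA T j , parent j (endB T j) (Joins-ends-of j) B→r , refl

    child : Fin k → Fin n
    child j = proj₁ (child-of j)

    child-end : ∀ j → IsEnd j (child j)
    child-end j with child-of j
    ... | v , parent .j s J _ , refl = Joins-end (Joins-sym J)

    child-injective : Injective _≡_ _≡_ child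
    child-injective {i} {j} = edges-agree (child-of i) (child-of j)
      where
      edges-agree : (Di : ChildOf i) (Dj : ChildOf j) → proj₁ Di ≡ proj₁ Dj → i ≡ j
      edges-agree (v , D , refl) (.v , D′ , refl) refl = parent-edge-unique D D′

  -- The side of T − j containing endA j, lifted to V along rep.
  S : Fin k → VSet n
  S j z = [ const true , const false ]′ (side (Joins-ends-of j) (rep-idem z))

  S-iff : ∀ j z → S j z ≡ true ⇔ Reach T (Without j) (endA T j) (rep z)
  S-iff j z with side (Joins-ends-of j) (rep-idem z)
  ... | inj₁ A→z = mk⇔ (const A→z) (const refl)
  ... | inj₂ B→z = mk⇔ (λ ()) (λ A→z → ⊥-elim (sides-disjoint (Joins-ends-of j) A→z B→z))

  S-mincut : ∀ j → IsMinCut G (endA T j) (endB T j) (S j) × cut G (S j) ≡ weight T j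
  S-mincut j = mincut-prop (endA T j) (endB T j) (proj₁ (ends-terminal j)) (proj₂ (ends-terminal j))
    (no-loop j) (j ∷ []) (_ , cons j (Joins-ends-of j) nil , (no-loop j ∷ []) ∷ [] ∷ [])
    j (here refl) (λ { _ (here refl) → ≤-refl }) (S j) (S-iff j)

  S-separates : Joins T j t s → Reach T (Without j) s (rep a) → ¬ Reach T (Without j) s (rep b) → S j a ≢ S j b
  S-separates {j} {a = a} {b = b} J s→a s↛b with side (Joins-ends-of j) (rep-idem a) | side (Joins-ends-of j) (rep-idem b)
  ... | inj₁ A→a | inj₁ A→b = λ _ → s↛b (Reach-trans s→a (Reach-trans (Reach-sym A→a) A→b))
  ... | inj₂ B→a | inj₂ B→b = λ _ → s↛b (Reach-trans s→a (Reach-trans (Reach-sym B→a) B→b))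
  ... | inj₁ _   | inj₂ _   = λ ()
  ... | inj₂ _   | inj₁ _   = λ ()

  weight≤degree : ∀ j {v} → IsEnd j v → weight T j ≤ cut G (singleton v)
  weight≤degree j {v} v-end = begin
    weight T j       ≡⟨ proj₂ (S-mincut j) ⟨
    cut G (S j)      ≤⟨ mincut≤endpoint v-end ⟩
    cut G (singleton v) ∎
    where
    open ≤-Reasoning
    is-mincut : ∀ S′ → Separates S′ (endA T j) (endB T j) → cut G (S j) ≤ cut G S′
    is-mincut = proj₂ (proj₁ (S-mincut j))
    mincut≤endpoint : IsEnd j v → cut G (S j) ≤ cut G (singleton v)
    mincut≤endpoint (inj₁ refl) =
      is-mincut (singleton v) (singleton-self v , singleton-≢ (λ B≡A → no-loop j (sym B≡A)))
    mincut≤endpoint (inj₂ refl) = begin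
      cut G (S j)
        ≤⟨ is-mincut (not ∘ singleton v) (cong not (singleton-≢ (no-loop j)) , cong not (singleton-self v)) ⟩
      cut G (not ∘ singleton v)    ≡⟨ cut-complement G (singleton v) ⟩
      cut G (singleton v)          ∎

edges≤vertices : ∀ {n k G rep} {T : WEdges n k} → PartialTree G rep T → k ≤ n
edges≤vertices {k = zero}          _  = z≤n
edges≤vertices {k = suc _} {T = T} PT =
  injective⇒≤ (Rooted.child-injective (endA T zero) (proj₁ (ends-terminal zero)))
  where open PartialTreeProperties PT; open PartialTree PT

sumTerminals-≤ : ∀ {n} (rep : Fin n → Fin n) {f g : Fin n → ℕ} →
                 (∀ t → Terminal rep t → f t ≤ g t) → sumTerminals rep f ≤ ∑[ t < n ] g t
sumTerminals-≤ {n} rep {f} {g} f≤g = begin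
  sumTerminals rep f                                    ≡⟨ sum-allFin n _ ⟩
  ∑[ t < n ] (if ⌊ rep t ≟ t ⌋ then f t else 0)        ≤⟨ ∑-mono-≤ gated ⟩
  ∑[ t < n ] g t ∎
  where
  open ≤-Reasoning
  gated : ∀ t → (if ⌊ rep t ≟ t ⌋ then f t else 0) ≤ g t
  gated t with rep t ≟ t
  ... | yes t-term = f≤g t t-term
  ... | no _       = z≤n

module _ {n k : ℕ} {G : List (Edge n)} {rep : Fin n → Fin n} {T : WEdges n k}
         (PT : PartialTree G rep T) where

  open PartialTree PT
  open Walks T
  open PartialTreeProperties PT
  open ParentEdge

  IsEnd? : ∀ j t → Dec (IsEnd j t)
  IsEnd? j t = (endA T j ≟ t) ⊎-dec (endB T j ≟ t)

  contraction-vertices≤ : ∀ {t n′ c} → Terminal rep t → IsContraction rep T t n′ c →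
                          n′ ≤ count (λ x → rep x ≟ t) + count (λ j → IsEnd? j t)
  contraction-vertices≤ {t} {n′} {c} t-term (c-surjective , c≡⇔) =
    injection-⊎-≤-count (λ x → rep x ≟ t) (λ j → IsEnd? j t) (code ∘ pre) (code∈ ∘ pre) code∘pre-injective
    where
    Entry : Fin n → Set
    Entry x = rep x ≢ t × ∃[ j ] ∃[ s ] Joins T j s t × Reach T (AllEdges ∩ Avoiding T t) (rep x) s

    classify : ∀ x → rep x ≡ t ⊎ Entry x
    classify x with rep x ≟ t
    ... | yes x∈Vt = inj₁ x∈Vt
    ... | no x∉Vt  = inj₂ (x∉Vt , first-entry (connected (rep x) t (rep-idem x) t-term) x∉Vt)

    code : Fin n → Fin n ⊎ Fin k
    code x = [ const (inj₁ x) , (λ e → inj₂ (proj₁ (proj₂ e))) ]′ (classify x)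

    code∈ : ∀ x → [ (λ x → rep x ≡ t) , (λ j → IsEnd j t) ]′ (code x)
    code∈ x with classify x
    ... | inj₁ x∈Vt                     = x∈Vt
    ... | inj₂ (_ , j , s , J , _)      = Joins-end J

    code-same : ∀ x x′ → code x ≡ code x′ → c x ≡ c x′
    code-same x x′ e with classify x | classify x′
    ... | inj₁ _ | inj₁ _ = cong c (inj₁-injective e)
    ... | inj₁ _ | inj₂ _ with () ← e
    ... | inj₂ _ | inj₁ _ with () ← e
    ... | inj₂ (x∉Vt , j , s , J , x→s) | inj₂ (x′∉Vt , j′ , s′ , J′ , x′→s′)
      with refl ← e with refl ← Joins-unique J J′ =
      Equivalence.from (c≡⇔ x x′)
        (inj₂ (x∉Vt , x′∉Vt , Reach-map proj₂ (Reach-trans x→s (Reach-sym x′→s′))))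

    pre : Fin n′ → Fin n
    pre i = proj₁ (c-surjective i)

    code∘pre-injective : ∀ {i i′} → code (pre i) ≡ code (pre i′) → i ≡ i′
    code∘pre-injective {i} {i′} e =
      trans (sym (proj₂ (c-surjective i) refl)) (trans (code-same _ _ e) (proj₂ (c-surjective i′) refl))

  ∑contracted-vertices≤3n : (n′ : Fin n → ℕ) (c : (t : Fin n) → Fin n → Fin (n′ t)) →
                            (∀ t → Terminal rep t → IsContraction rep T t (n′ t) (c t)) →
                            sumTerminals rep n′ ≤ 3 * n
  ∑contracted-vertices≤3n n′ c contracts = begin
    sumTerminals rep n′
      ≤⟨ sumTerminals-≤ rep (λ t t-term → contraction-vertices≤ t-term (contracts t t-term)) ⟩
    ∑[ t < n ] (count (λ x → rep x ≟ t) + count (λ j → IsEnd? j t))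
      ≡⟨ ∑-distrib-+ (λ t → count (λ x → rep x ≟ t)) _ ⟩
    ∑[ t < n ] count (λ x → rep x ≟ t) + ∑[ t < n ] count (λ j → IsEnd? j t)
      ≡⟨ cong₂ _+_ (∑-comm (λ t x → 𝟙 (rep x ≟ t))) (∑-comm (λ t j → 𝟙 (IsEnd? j t))) ⟩
    ∑[ x < n ] count (λ t → rep x ≟ t) + ∑[ j < k ] count (λ t → IsEnd? j t)
      ≤⟨ +-mono-≤ (∑-mono-≤ (count-preimage-≤-1 id ∘ rep)) (∑-mono-≤ two-ends) ⟩
    count {n} (λ _ → yes tt) + ∑[ j < k ] 2
      ≡⟨ cong₂ _+_ (count-all n) (trans (∑-const k 2) (*-comm k 2)) ⟩
    n + 2 * k
      ≤⟨ +-monoʳ-≤ n (*-monoʳ-≤ 2 (edges≤vertices PT)) ⟩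
    3 * n ∎
    where
    open ≤-Reasoning
    two-ends : ∀ j → count (λ t → IsEnd? j t) ≤ 2
    two-ends j = ≤-trans (count-∪ (λ t → endA T j ≟ t) (λ t → endB T j ≟ t))
                         (+-mono-≤ (count-preimage-≤-1 id (endA T j)) (count-preimage-≤-1 id (endB T j)))

  module _ (n′ : Fin n → ℕ) (c : (t : Fin n) → Fin n → Fin (n′ t))
           (contracts : ∀ t → Terminal rep t → IsContraction rep T t (n′ t) (c t)) where

    Kept? : ∀ t (e : Edge n) → Dec (Terminal rep t × c t (proj₁ e) ≢ c t (proj₂ e))
    Kept? t (x , y) = (rep t ≟ t) ×-dec ¬? (c t x ≟ c t y)

    kept≤1+crossing : ∀ e → count (λ t → Kept? t e) ≤ 1 + count (λ j → crosses? (S j) e)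
    kept≤1+crossing (x , y) = ≤-trans (count-split (λ t → Kept? t (x , y)) (λ t → t ≟ rep x))
      (+-mono-≤ (count-≤-1 (λ t → t ≟ rep x) (λ _ _ t≡ t′≡ → trans t≡ (sym t′≡)))
                (count-injection _ (λ j → crosses? (S j) (x , y)) (λ t p → edge (D t p)) crossing
                   (λ t t′ p p′ → parent-edge-injective (D t p) (D t′ p′))))
      where
      D : ∀ t → (Terminal rep t × c t x ≢ c t y) × t ≢ rep x → ParentEdge (rep x) t
      D t ((t-term , _) , t≢x) = parent-edge (rep-idem x) t-term t≢x

      crossing : ∀ t p → S (edge (D t p)) x ≢ S (edge (D t p)) y
      crossing t p@((t-term , kept) , t≢x) =
        S-separates (joins (D t p)) (toward (D t p)) (parent-edge-separates (D t p) cut-off)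
        where
        cut-off : ¬ Reach T (Avoiding T t) (rep x) (rep y)
        cut-off ρ = kept (Equivalence.from (proj₂ (contracts t t-term) x y)
                           (inj₂ (x≢t , Reach-avoiding-≢ ρ x≢t , ρ)))
          where
          x≢t : rep x ≢ t
          x≢t x≡t = t≢x (sym x≡t)

    ∑kept≤ : (H : List (Edge n)) →
             ∑[ t < n ] length (filter (Kept? t) H) ≤ length H + ∑[ j < k ] cut H (S j)
    ∑kept≤ H = begin
      ∑[ t < n ] length (filter (Kept? t) H)
        ≡⟨ ∑-length-filter Kept? H ⟩
      sum (map (λ e → count (λ t → Kept? t e)) H)
        ≤⟨ sum-map-mono-≤ kept≤1+crossing H ⟩
      sum (map (λ e → 1 + count (λ j → crosses? (S j) e)) H)
        ≡⟨ sum-map-+ H ⟩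
      sum (map (λ _ → 1) H) + sum (map (λ e → count (λ j → crosses? (S j) e)) H)
        ≡⟨ cong₂ _+_ (trans (sum-map-const 1 H) (*-identityˡ (length H)))
                     (sym (∑-length-filter (λ j → crosses? (S j)) H)) ⟩
      length H + ∑[ j < k ] cut H (S j) ∎
      where open ≤-Reasoning

    ∑contracted-edges≤ : ∀ {H} → H ⊆ G →
                         sumTerminals rep (λ t → contractedEdges H (c t)) ≤ length H + ∑[ j < k ] weight T j
    ∑contracted-edges≤ {H} H⊆G = begin
      sumTerminals rep (λ t → contractedEdges H (c t))
        ≤⟨ sumTerminals-≤ rep (λ t t-term → length-filter-mono _ (Kept? t) (λ _ kept → t-term , kept) H) ⟩
      ∑[ t < n ] length (filter (Kept? t) H)
        ≤⟨ ∑kept≤ H ⟩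
      length H + ∑[ j < k ] cut H (S j)
        ≤⟨ +-monoʳ-≤ (length H) (∑-mono-≤ (λ j → cut-mono-⊆ (S j) H⊆G)) ⟩
      length H + ∑[ j < k ] cut G (S j)
        ≡⟨ cong (length H +_) (sum-cong-≗ (λ j → proj₂ (S-mincut j))) ⟩
      length H + ∑[ j < k ] weight T j ∎
      where open ≤-Reasoning

∑weight≤2m : ∀ {n k G rep} {T : WEdges n k} → PartialTree G rep T → ∑[ j < k ] weight T j ≤ 2 * length G
∑weight≤2m {k = zero}                  _  = z≤n
∑weight≤2m {k = suc k} {G} {T = T} PT = begin
  ∑[ j < suc k ] weight T j                     ≤⟨ ∑-mono-≤ (λ j → weight≤degree j (child-end j)) ⟩
  ∑[ j < suc k ] cut G (singleton (child j))    ≤⟨ ∑-cut-singleton-≤ G child child-injective ⟩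
  2 * length G                                  ∎
  where
  open ≤-Reasoning
  open PartialTreeProperties PT
  open Rooted (endA T zero) (proj₁ (PartialTree.ends-terminal PT zero))

∑weight≤2dn : ∀ {n k G rep} {T : WEdges n k} → PartialTree G rep T → ∀ d → CapturesNoneAbove T d →
              ∑[ j < k ] weight T j ≤ n * (2 * d)
∑weight≤2dn {n} {k} {T = T} PT d light = begin
  ∑[ j < k ] weight T j ≤⟨ ∑-mono-≤ light ⟩
  ∑[ j < k ] (2 * d)    ≡⟨ ∑-const k (2 * d) ⟩
  k * (2 * d)           ≤⟨ *-monoˡ-≤ (2 * d) (edges≤vertices PT) ⟩
  n * (2 * d)           ∎
  where open ≤-Reasoning

proposition3p1 : ∀ (n : ℕ) (G : List (Edge n)) → SimpleGraph G →
    ∀ (d : ℕ) → 0 < d →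
    ∀ (H : List (Edge n)) → H ⊆ G → Certificate G H (3 * d) →
    length H ≤ length G ⊓ (3 * n * d) →
    ∀ (k : ℕ) (rep : Fin n → Fin n) (T : WEdges n k) →
    PartialTree G rep T → CapturesAllUpTo G rep d → CapturesNoneAbove T d →
    ∀ (n' : Fin n → ℕ) (c : (t : Fin n) → Fin n → Fin (n' t)) →
    (∀ t → Terminal rep t → IsContraction rep T t (n' t) (c t)) →
    sumTerminals rep n' ≤ 3 * n
    × sumTerminals rep (λ t → contractedEdges H (c t)) ≤ (3 * length G) ⊓ (5 * n * d)
proposition3p1 n G _ d _ H H⊆G _ |H|≤m⊓3nd k rep T PT _ light n′ c contracts =
    ∑contracted-vertices≤3n PT n′ c contracts
  , ≤-trans (∑contracted-edges≤ PT n′ c contracts H⊆G)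
            (⊓-glb (+-mono-≤ (m≤n⊓o⇒m≤n _ _ |H|≤m⊓3nd) (∑weight≤2m PT))
                   (≤-trans (+-mono-≤ (m≤n⊓o⇒m≤o _ _ |H|≤m⊓3nd) (∑weight≤2dn PT d light))
                            (≤-reflexive (3nd+2nd≡5nd n d))))
  where
  3nd+2nd≡5nd : ∀ n d → 3 * n * d + n * (2 * d) ≡ 5 * n * d
  3nd+2nd≡5nd = solve-∀
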